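{- For positive integers $d,m,n$ with $n\ge 6$ even and $d \le n/2$, we have \[ S(n,m+d) \ge \left(1-\frac{2d}{n}\right)^2 S(n,m) + dn - d^2 - n. \]
   Context: A graph $G=(V,E)$ on $n$ vertices is called nice if it is $K_4$-free and there is a partition $V = X\cup Y$ into two parts each of size $n/2$ such that each of $G[X]$ and $G[Y]$ is triangle-free. $S(n,m)$ denotes the maximum number of edges of a nice graph on $n$ vertices with independence number less than $m$. -}

module Defs where

open import Data.Nat using (ℕ; _+_; _*_; _∸_; _<_; _≤_; _<ᵇ_)
open import Data.Bool using (Bool; true; false; _∧_; if_then_else_)
open import Data.Fin using (Fin; toℕ)
open import Data.Fin.Subset using (Subset; _∈_; ∣_∣; ∁)
open import Data.Nat.ListAction using (sum)
open import Data.List using (List; map; allFin; cartesianProduct)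
open import Data.Product using (_×_; _,_; Σ; ∃)
open import Relation.Binary.PropositionalEquality using (_≡_; _≢_)
open import Relation.Nullary using (¬_)

record Graph (n : ℕ) : Set where
  field
    Adj   : Fin n → Fin n → Bool
    sym   : ∀ i j → Adj i j ≡ Adj j i
    irrefl : ∀ i → Adj i i ≡ false
open Graph public

_∼[_]_ : {n : ℕ} → Fin n → Graph n → Fin n → Set
i ∼[ G ] j = Adj G i j ≡ true

edgeCount : {n : ℕ} → Graph n → ℕ
edgeCount {n} G =
  sum (map (λ { (i , j) → if (toℕ i <ᵇ toℕ j) ∧ Adj G i j then 1 else 0 })
           (cartesianProduct (allFin n) (allFin n)))

-- G contains no K4 (four distinct pairwise adjacent vertices; adjacency already forces distinctness)
K4Free : {n : ℕ} → Graph n → Set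
K4Free G = ∀ a b c d →
  ¬ (a ∼[ G ] b × a ∼[ G ] c × a ∼[ G ] d × b ∼[ G ] c × b ∼[ G ] d × c ∼[ G ] d)

TriangleFreeOn : {n : ℕ} → Graph n → Subset n → Set
TriangleFreeOn G X = ∀ a b c → a ∈ X → b ∈ X → c ∈ X →
  ¬ (a ∼[ G ] b × a ∼[ G ] c × b ∼[ G ] c)

Nice : {n : ℕ} → Graph n → Set
Nice {n} G = K4Free G × Σ (Subset n) λ X →
  (∣ X ∣ + ∣ X ∣ ≡ n) × TriangleFreeOn G X × TriangleFreeOn G (∁ X)

Independent : {n : ℕ} → Graph n → Subset n → Set
Independent G S = ∀ i j → i ∈ S → j ∈ S → ¬ (i ∼[ G ] j)

AlphaLt : {n : ℕ} → Graph n → ℕ → Set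
AlphaLt G m = ∀ S → Independent G S → ∣ S ∣ < m

IsS : ℕ → ℕ → ℕ → Set
IsS n m s =
  (Σ (Graph n) λ G → Nice G × AlphaLt G m × edgeCount G ≡ s) ×
  (∀ (G : Graph n) → Nice G → AlphaLt G m → edgeCount G ≤ s)

module Submission where

-- Let G be an extremal nice graph for S(n, m), with halves X and Y of size k = n/2. Delete, d times,
-- a vertex of least remaining degree from each half: with t vertices left per half the two deleted
-- vertices carry at most a 1/t share of the degree sum, so each round keeps a (t - 2)/t fraction of
-- it and altogether (k - d)(k - d - 1)/(k (k - 1)) of the edges survive. Now join each of the 2d
-- deleted vertices to every vertex of the opposite half. Each half stays triangle-free, a K4 through
-- a joined vertex would need a triangle in one half, and an independent set meets the joined
-- vertices in one half only, so the new graph is nice with independence number below m + d. It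
-- gains 2kd - d² edges, and comparing its size with S(n, m + d) gives the inequality.

open import Algebra.Properties.CommutativeSemigroup using (interchange)
open import Data.Bool using (Bool; true; false; not; _∧_; _∨_; _xor_; if_then_else_)
open import Data.Bool.Properties
  using (∧-comm; ∧-zeroʳ; ∨-comm; ∨-identityʳ; xor-comm; xor-same; xor-inverseʳ; ¬-not)
  renaming (_≟_ to _≟ᵇ_)
open import Data.Empty using (⊥)
open import Data.Fin as Fin using (Fin; toℕ)
open import Data.Fin.Properties using (toℕ-injective; any?) renaming (_≟_ to _≟ᶠ_)
open import Data.Fin.Subset using (Subset; _∈_; ∣_∣; ∁)
open import Data.Fin.Subset.Properties using (∣∁p∣≡n∸∣p∣)
open import Data.List using (List; []; _∷_; _++_; map; allFin; cartesianProduct; tabulate)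
open import Data.List.Properties using (map-++; map-∘; map-tabulate)
open import Data.Nat
  using (ℕ; zero; suc; _+_; _*_; _∸_; _≤_; _<_; _^_; z≤n; s≤s; s≤s⁻¹; _<ᵇ_; >-nonZero)
open import Data.Nat.Divisibility using (_∣_)
import Data.Nat.ListAction as List
open import Data.Nat.ListAction.Properties using (sum-++)
open import Data.Nat.Properties
open import Data.Nat.Tactic.RingSolver using (solve-∀)
open import Data.Product using (∃-syntax; _×_; _,_; proj₁; proj₂)
open import Data.Sum using (_⊎_; inj₁; inj₂)
open import Data.Vec using ([]; _∷_; lookup) renaming (tabulate to tabulateᵛ)
open import Data.Vec.Properties using (lookup∘tabulate; []=⇒lookup; lookup⇒[]=; lookup-map)
open import Defs hiding (sym)
open import Function using (_∘_; id)
open import Relation.Binary.PropositionalEquality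
open import Relation.Nullary.Decidable using (does; yes; no)
open import Relation.Nullary.Negation using (¬_; contradiction)
open import Relation.Nullary.Reflects using (ofʸ; ofⁿ)

open import Algebra.Properties.CommutativeMonoid.Sum +-0-commutativeMonoid using (sum; sum-cong-≗)

-- The same shape as the summand of edgeCount, so that the two agree definitionally.
𝟙 : Bool → ℕ
𝟙 b = if b then 1 else 0

count : ∀ {n} → (Fin n → Bool) → ℕ
count P = sum (λ i → 𝟙 (P i))

∧≡true⁻ : ∀ {x y} → x ∧ y ≡ true → x ≡ true × y ≡ true
∧≡true⁻ {true} {true} refl = refl , refl

not-≡true : ∀ {b} → not b ≡ true → b ≡ false
not-≡true {false} refl = refl

sum-mono-≤ : ∀ {n} {f g : Fin n → ℕ} → (∀ i → f i ≤ g i) → sum f ≤ sum g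
sum-mono-≤ {zero}  f≤g = z≤n
sum-mono-≤ {suc n} f≤g = +-mono-≤ (f≤g Fin.zero) (sum-mono-≤ (f≤g ∘ Fin.suc))

sum-+ : ∀ {n} (f g : Fin n → ℕ) → sum (λ i → f i + g i) ≡ sum f + sum g
sum-+ {zero}  f g = refl
sum-+ {suc n} f g = trans (cong (f Fin.zero + g Fin.zero +_) (sum-+ (f ∘ Fin.suc) (g ∘ Fin.suc)))
                          (interchange +-commutativeSemigroup (f Fin.zero) (g Fin.zero) _ _)

sum-*ˡ : ∀ {n} c (f : Fin n → ℕ) → sum (λ i → c * f i) ≡ c * sum f
sum-*ˡ {zero}  c f = sym (*-zeroʳ c)
sum-*ˡ {suc n} c f = trans (cong (c * f Fin.zero +_) (sum-*ˡ c (f ∘ Fin.suc)))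
                           (sym (*-distribˡ-+ c _ _))

sum-const : ∀ {n} c → sum {n} (λ _ → c) ≡ n * c
sum-const {zero}  c = refl
sum-const {suc n} c = cong (c +_) (sum-const {n} c)

sum-zero : ∀ {n} → sum {n} (λ _ → 0) ≡ 0
sum-zero {n} = trans (sum-const {n} 0) (*-zeroʳ n)

sum-swap : ∀ {m n} (f : Fin m → Fin n → ℕ) → sum (λ i → sum (f i)) ≡ sum (λ j → sum (λ i → f i j))
sum-swap {zero}  {n} f = sym (sum-zero {n})
sum-swap {suc m} {n} f = trans (cong (sum (f Fin.zero) +_) (sum-swap (f ∘ Fin.suc)))
                               (sym (sum-+ (f Fin.zero) _))

sum-𝟙≟ : ∀ {n} (x : Fin n) (f : Fin n → ℕ) → sum (λ i → 𝟙 (does (i ≟ᶠ x)) * f i) ≡ f x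
sum-𝟙≟ {suc n} Fin.zero    f = trans (cong (f Fin.zero + 0 +_) (sum-zero {n}))
                                     (trans (+-identityʳ _) (+-identityʳ _))
sum-𝟙≟ {suc n} (Fin.suc x) f = sum-𝟙≟ x (f ∘ Fin.suc)

sum₂ : ∀ {m n} → (Fin m → Fin n → ℕ) → ℕ
sum₂ f = sum (λ i → sum (f i))

sum₂-+ : ∀ {m n} (f g : Fin m → Fin n → ℕ) → sum₂ (λ i j → f i j + g i j) ≡ sum₂ f + sum₂ g
sum₂-+ f g = trans (sum-cong-≗ (λ i → sum-+ (f i) (g i))) (sum-+ (λ i → sum (f i)) (λ i → sum (g i)))

sum₂-cong : ∀ {m n} {f g : Fin m → Fin n → ℕ} → (∀ i j → f i j ≡ g i j) → sum₂ f ≡ sum₂ g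
sum₂-cong f≡g = sum-cong-≗ (λ i → sum-cong-≗ (f≡g i))

x+y+y≡x+2y : ∀ x y → x + y + y ≡ x + 2 * y
x+y+y≡x+2y = solve-∀

infixr 7 _∩_
infixl 6 _∪⁅_⁆

_∩_ : ∀ {n} → (Fin n → Bool) → (Fin n → Bool) → Fin n → Bool
(P ∩ Q) i = P i ∧ Q i

⁅_⁆ : ∀ {n} → Fin n → Fin n → Bool
⁅ x ⁆ i = does (i ≟ᶠ x)

_∪⁅_⁆ : ∀ {n} → (Fin n → Bool) → Fin n → Fin n → Bool
(P ∪⁅ x ⁆) i = P i ∨ ⁅ x ⁆ i

count-split : ∀ {n} (P Q : Fin n → Bool) → count P ≡ count (P ∩ Q) + count (P ∩ (not ∘ Q))
count-split P Q = trans (sum-cong-≗ (λ i → 𝟙-split (P i) (Q i)))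
                        (sum-+ (𝟙 ∘ (P ∩ Q)) (𝟙 ∘ (P ∩ (not ∘ Q))))
  where
  𝟙-split : ∀ p q → 𝟙 p ≡ 𝟙 (p ∧ q) + 𝟙 (p ∧ not q)
  𝟙-split false q     = refl
  𝟙-split true  true  = refl
  𝟙-split true  false = refl

count-∩-not : ∀ {n} (P Q : Fin n → Bool) {j k} →
  count P ≡ k → count (P ∩ Q) ≡ j → count (P ∩ (not ∘ Q)) ≡ k ∸ j
count-∩-not P Q {j} |P| |P∩Q| = begin
  count (P ∩ (not ∘ Q))                                  ≡⟨ m+n∸m≡n (count (P ∩ Q)) _ ⟨
  count (P ∩ Q) + count (P ∩ (not ∘ Q)) ∸ count (P ∩ Q)  ≡⟨ cong₂ _∸_ (trans (sym (count-split P Q)) |P|) |P∩Q| ⟩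
  _ ∸ j                                                  ∎
  where open ≡-Reasoning

count-∪⁅⁆ : ∀ {n} (P R : Fin n → Bool) {x} → R x ≡ false →
  count (P ∩ (R ∪⁅ x ⁆)) ≡ 𝟙 (P x) + count (P ∩ R)
count-∪⁅⁆ P R {x} Rx≡false = begin
  count (P ∩ (R ∪⁅ x ⁆))                       ≡⟨ sum-cong-≗ pointwise ⟩
  sum (λ i → at-x i + 𝟙 (P i ∧ R i))           ≡⟨ sum-+ at-x (𝟙 ∘ (P ∩ R)) ⟩
  sum at-x + count (P ∩ R)                     ≡⟨ cong (_+ count (P ∩ R)) (sum-𝟙≟ x (𝟙 ∘ P)) ⟩
  𝟙 (P x) + count (P ∩ R)                      ∎
  where
  open ≡-Reasoning
  at-x : Fin _ → ℕ
  at-x i = 𝟙 (does (i ≟ᶠ x)) * 𝟙 (P i)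
  pointwise : ∀ i → 𝟙 (P i ∧ (R i ∨ does (i ≟ᶠ x))) ≡ at-x i + 𝟙 (P i ∧ R i)
  pointwise i with i ≟ᶠ x
  ... | no _ = cong (λ b → 𝟙 (P i ∧ b)) (∨-identityʳ (R i))
  ... | yes refl rewrite Rx≡false with P i
  ...   | true  = refl
  ...   | false = refl

∪⁅⁆-∉ : ∀ {n} (R : Fin n → Bool) {x y} → R y ≡ false → y ≢ x → (R ∪⁅ x ⁆) y ≡ false
∪⁅⁆-∉ R {x} {y} Ry≡false y≢x with y ≟ᶠ x
... | yes y≡x = contradiction y≡x y≢x
... | no _    = trans (∨-identityʳ _) Ry≡false

count-∄ : ∀ {n} {P : Fin n → Bool} → (∀ i → P i ≢ true) → count P ≡ 0
count-∄ {n} ∄P = trans (sum-cong-≗ (λ i → cong 𝟙 (¬-not (∄P i)))) (sum-zero {n})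

count-mono-≤ : ∀ {n} (P Q : Fin n → Bool) → (∀ i → P i ≡ true → Q i ≡ true) → count P ≤ count Q
count-mono-≤ P Q P⇒Q = sum-mono-≤ 𝟙-mono
  where
  𝟙-mono : ∀ i → 𝟙 (P i) ≤ 𝟙 (Q i)
  𝟙-mono i with P i in Pi
  ... | true  = ≤-reflexive (cong 𝟙 (sym (P⇒Q i Pi)))
  ... | false = z≤n

count-∩-comm : ∀ {n} (P Q : Fin n → Bool) → count (P ∩ Q) ≡ count (Q ∩ P)
count-∩-comm P Q = sum-cong-≗ (λ i → cong 𝟙 (∧-comm (P i) (Q i)))

∃⊎count≡0 : ∀ {n} (P : Fin n → Bool) → (∃[ i ] P i ≡ true) ⊎ count P ≡ 0
∃⊎count≡0 P with any? (λ i → P i ≟ᵇ true)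
... | yes ∃P = inj₁ ∃P
... | no ∄P  = inj₂ (count-∄ (λ i Pi → ∄P (i , Pi)))

∃-minimum : ∀ {n} (P : Fin n → Bool) (f : Fin n → ℕ) → ∃[ x ] P x ≡ true →
  ∃[ x ] P x ≡ true × (∀ i → P i ≡ true → f x ≤ f i)
∃-minimum {suc n} P f (x , Px) with any? (λ i → P (Fin.suc i) ≟ᵇ true)
... | no ∄P = Fin.zero , subst (λ i → P i ≡ true) (only-zero x Px) Px ,
              λ i Pi → ≤-reflexive (cong f (sym (only-zero i Pi)))
  where
  only-zero : ∀ i → P i ≡ true → i ≡ Fin.zero
  only-zero Fin.zero    _  = refl
  only-zero (Fin.suc j) Pj = contradiction (j , Pj) ∄P
... | yes ∃P with ∃-minimum (P ∘ Fin.suc) (f ∘ Fin.suc) ∃P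
...   | m , Pm , m-minimal with P Fin.zero in P0≡ | f Fin.zero ≤? f (Fin.suc m)
...     | true  | yes f0≤fm = Fin.zero , P0≡ , λ
  { Fin.zero    _  → ≤-refl
  ; (Fin.suc j) Pj → ≤-trans f0≤fm (m-minimal j Pj) }
...     | true  | no f0≰fm = Fin.suc m , Pm , λ
  { Fin.zero    _  → <⇒≤ (≰⇒> f0≰fm)
  ; (Fin.suc j) Pj → m-minimal j Pj }
...     | false | _ = Fin.suc m , Pm , λ
  { Fin.zero    P0 → contradiction (trans (sym P0≡) P0) λ ()
  ; (Fin.suc j) Pj → m-minimal j Pj }

∃-below-average : ∀ {n} (P : Fin n → Bool) (f : Fin n → ℕ) → 0 < count P →
  ∃[ x ] P x ≡ true × count P * f x ≤ sum (λ i → 𝟙 (P i) * f i)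
∃-below-average P f 0<|P| with ∃⊎count≡0 P
... | inj₂ |P|≡0 = contradiction |P|≡0 (>⇒≢ 0<|P|)
... | inj₁ ∃P with ∃-minimum P f ∃P
...   | x , Px , x-minimal = x , Px , below
  where
  below : count P * f x ≤ sum (λ i → 𝟙 (P i) * f i)
  below = begin
    count P * f x                  ≡⟨ *-comm (count P) (f x) ⟩
    f x * count P                  ≡⟨ sum-*ˡ (f x) (𝟙 ∘ P) ⟨
    sum (λ i → f x * 𝟙 (P i))      ≤⟨ sum-mono-≤ bound ⟩
    sum (λ i → 𝟙 (P i) * f i)      ∎
    where
    open ≤-Reasoning
    bound : ∀ i → f x * 𝟙 (P i) ≤ 𝟙 (P i) * f i
    bound i with P i in Pi
    ... | true  = subst₂ _≤_ (sym (*-identityʳ (f x))) (sym (+-identityʳ (f i))) (x-minimal i Pi)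
    ... | false = ≤-reflexive (*-zeroʳ (f x))

-- Degree sums and the handshake lemma

List-sum-tabulate : ∀ {n} (f : Fin n → ℕ) → List.sum (tabulate f) ≡ sum f
List-sum-tabulate {zero}  f = refl
List-sum-tabulate {suc n} f = cong (f Fin.zero +_) (List-sum-tabulate (f ∘ Fin.suc))

List-sum-allFin : ∀ {n} (f : Fin n → ℕ) → List.sum (map f (allFin n)) ≡ sum f
List-sum-allFin f = trans (cong List.sum (map-tabulate id f)) (List-sum-tabulate f)

List-sum-cartesianProduct : ∀ {A B : Set} (xs : List A) (ys : List B) (f : A × B → ℕ) →
  List.sum (map f (cartesianProduct xs ys)) ≡ List.sum (map (λ x → List.sum (map (λ y → f (x , y)) ys)) xs)
List-sum-cartesianProduct []       ys f = refl
List-sum-cartesianProduct (x ∷ xs) ys f = begin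
  List.sum (map f (map (x ,_) ys ++ cartesianProduct xs ys))
    ≡⟨ cong List.sum (map-++ f (map (x ,_) ys) _) ⟩
  List.sum (map f (map (x ,_) ys) ++ map f (cartesianProduct xs ys))
    ≡⟨ sum-++ (map f (map (x ,_) ys)) _ ⟩
  List.sum (map f (map (x ,_) ys)) + List.sum (map f (cartesianProduct xs ys))
    ≡⟨ cong₂ _+_ (cong List.sum (sym (map-∘ ys))) (List-sum-cartesianProduct xs ys f) ⟩
  _ ∎
  where open ≡-Reasoning

degree : ∀ {n} → (Fin n → Fin n → Bool) → Fin n → ℕ
degree A u = count (A u)

degreeSum : ∀ {n} → (Fin n → Fin n → Bool) → ℕ
degreeSum A = sum (degree A)

degreeSum-≤ : ∀ {n} (A : Fin n → Fin n → Bool) → degreeSum A ≤ n * n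
degreeSum-≤ {n} A = ≤-trans (sum-mono-≤ degree-≤) (≤-reflexive (sum-const {n} n))
  where
  𝟙≤1 : ∀ b → 𝟙 b ≤ 1
  𝟙≤1 true  = ≤-refl
  𝟙≤1 false = z≤n
  degree-≤ : ∀ u → degree A u ≤ n
  degree-≤ u = ≤-trans (sum-mono-≤ (𝟙≤1 ∘ A u)) (≤-reflexive (trans (sum-const {n} 1) (*-identityʳ n)))

module _ {n} (G : Graph n) where

  private
    _≺_ : Fin n → Fin n → Bool
    u ≺ v = toℕ u <ᵇ toℕ v

  𝟙-adj-split : ∀ u v → 𝟙 (Adj G u v) ≡ 𝟙 (u ≺ v ∧ Adj G u v) + 𝟙 (v ≺ u ∧ Adj G v u)
  𝟙-adj-split u v with u ≺ v | <ᵇ-reflects-< (toℕ u) (toℕ v) | v ≺ u | <ᵇ-reflects-< (toℕ v) (toℕ u)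
  ... | true  | ofʸ u<v | true  | ofʸ v<u = contradiction v<u (<⇒≯ u<v)
  ... | true  | _       | false | _       = sym (+-identityʳ _)
  ... | false | _       | true  | _       = cong 𝟙 (Graph.sym G u v)
  ... | false | ofⁿ u≮v | false | ofⁿ v≮u
    rewrite toℕ-injective (≤-antisym (≮⇒≥ v≮u) (≮⇒≥ u≮v)) = cong 𝟙 (irrefl G v)

  handshake : edgeCount G + edgeCount G ≡ degreeSum (Adj G)
  handshake = begin
    edgeCount G + edgeCount G                   ≡⟨ cong₂ _+_ edgeCount-sum (trans edgeCount-sum (sum-swap E)) ⟩
    sum₂ E + sum₂ (λ u v → E v u)               ≡⟨ sum₂-+ E (λ u v → E v u) ⟨
    sum₂ (λ u v → E u v + E v u)                ≡⟨ sum₂-cong 𝟙-adj-split ⟨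
    degreeSum (Adj G)                           ∎
    where
    open ≡-Reasoning
    E : Fin n → Fin n → ℕ
    E u v = 𝟙 (u ≺ v ∧ Adj G u v)
    edgeCount-sum : edgeCount G ≡ sum₂ E
    edgeCount-sum = trans (List-sum-cartesianProduct (allFin n) (allFin n) _)
      (trans (List-sum-allFin (λ u → List.sum (map (E u) (allFin n))))
             (sum-cong-≗ (λ u → List-sum-allFin (E u))))

-- Greedy deletion of low-degree vertices

Undirected : ∀ {n} → (Fin n → Fin n → Bool) → Set
Undirected A = ∀ u v → A u v ≡ A v u

infixl 5 _∖_

_∖_ : ∀ {n} → (Fin n → Fin n → Bool) → (Fin n → Bool) → Fin n → Fin n → Bool
(A ∖ T) u v = (not (T u) ∧ not (T v)) ∧ A u v

module _ {n} (A : Fin n → Fin n → Bool) where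

  ∖-undirected : ∀ {T} → Undirected A → Undirected (A ∖ T)
  ∖-undirected {T} A-sym u v = cong₂ _∧_ (∧-comm (not (T u)) (not (T v))) (A-sym u v)

  ∖-∖ : ∀ R T u v → ((A ∖ R) ∖ T) u v ≡ (A ∖ (λ w → R w ∨ T w)) u v
  ∖-∖ R T u v with R u | R v
  ... | true  | _     = ∧-zeroʳ _
  ... | false | true  = trans (∧-zeroʳ _) (sym (cong (_∧ A u v) (∧-zeroʳ (not (T u)))))
  ... | false | false = refl

  degree-∖-≤ : ∀ T u → degree (A ∖ T) u ≤ degree A u
  degree-∖-≤ T u = sum-mono-≤ (λ v → 𝟙-∧-≤ (not (T u) ∧ not (T v)) (A u v))
    where
    𝟙-∧-≤ : ∀ b a → 𝟙 (b ∧ a) ≤ 𝟙 a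
    𝟙-∧-≤ true  a = ≤-refl
    𝟙-∧-≤ false a = z≤n

  degreeSum-∖ : Undirected A → ∀ T →
    degreeSum A ≤ degreeSum (A ∖ T) + 2 * sum (λ u → 𝟙 (T u) * degree A u)
  degreeSum-∖ A-sym T = begin
    degreeSum A                                   ≤⟨ sum-mono-≤ (λ u → sum-mono-≤ (bound u)) ⟩
    sum₂ (λ u v → kept u v + row u v + col u v)   ≡⟨ sum₂-+ (λ u v → kept u v + row u v) col ⟩
    sum₂ (λ u v → kept u v + row u v) + sum₂ col  ≡⟨ cong₂ _+_ (sum₂-+ kept row) columns ⟩
    degreeSum (A ∖ T) + sum₂ row + W              ≡⟨ cong (λ r → degreeSum (A ∖ T) + r + W) rows ⟩
    degreeSum (A ∖ T) + W + W                     ≡⟨ x+y+y≡x+2y (degreeSum (A ∖ T)) W ⟩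
    degreeSum (A ∖ T) + 2 * W                     ∎
    where
    open ≤-Reasoning
    W = sum (λ u → 𝟙 (T u) * degree A u)
    kept row col : Fin n → Fin n → ℕ
    kept u v = 𝟙 ((A ∖ T) u v)
    row  u v = 𝟙 (T u) * 𝟙 (A u v)
    col  u v = 𝟙 (T v) * 𝟙 (A u v)
    𝟙-≤ : ∀ t t′ a → 𝟙 a ≤ 𝟙 ((not t ∧ not t′) ∧ a) + 𝟙 t * 𝟙 a + 𝟙 t′ * 𝟙 a
    𝟙-≤ _     _     false = z≤n
    𝟙-≤ true  _     true  = s≤s z≤n
    𝟙-≤ false true  true  = s≤s z≤n
    𝟙-≤ false false true  = s≤s z≤n
    bound : ∀ u v → 𝟙 (A u v) ≤ kept u v + row u v + col u v
    bound u v = 𝟙-≤ (T u) (T v) (A u v)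
    rows : sum₂ row ≡ W
    rows = sum-cong-≗ (λ u → sum-*ˡ (𝟙 (T u)) (𝟙 ∘ A u))
    columns : sum₂ col ≡ W
    columns = trans (sum-swap col) (sum-cong-≗ (λ v →
      trans (sum-cong-≗ (λ u → cong (λ b → 𝟙 (T v) * 𝟙 b) (A-sym u v)))
            (sum-*ˡ (𝟙 (T v)) (𝟙 ∘ A v))))

removal-bound : ∀ t z e e′ → t * z ≤ e → e ≤ e′ + 2 * z → e * (t ∸ 2) ≤ e′ * t
removal-bound t z e e′ tz≤e e≤e′+2z = begin
  e * (t ∸ 2)    ≡⟨ *-distribˡ-∸ e t 2 ⟩
  e * t ∸ e * 2  ≤⟨ m≤n+o⇒m∸n≤o (e * t) (e * 2) et≤ ⟩
  e′ * t         ∎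
  where
  open ≤-Reasoning
  expand : ∀ e′ z t → (e′ + 2 * z) * t ≡ 2 * (t * z) + e′ * t
  expand = solve-∀
  et≤ : e * t ≤ e * 2 + e′ * t
  et≤ = begin
    e * t                 ≤⟨ *-monoˡ-≤ t e≤e′+2z ⟩
    (e′ + 2 * z) * t      ≡⟨ expand e′ z t ⟩
    2 * (t * z) + e′ * t  ≤⟨ +-monoˡ-≤ (e′ * t) (*-monoʳ-≤ 2 tz≤e) ⟩
    2 * e + e′ * t        ≡⟨ cong (_+ e′ * t) (*-comm 2 e) ⟩
    e * 2 + e′ * t        ∎

m∸n∸1≡m∸[1+n] : ∀ m n → m ∸ n ∸ 1 ≡ m ∸ suc n
m∸n∸1≡m∸[1+n] m n = trans (∸-+-assoc m n 1) (cong (m ∸_) (+-comm n 1))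

-- A round that shrinks the degree sum by at most the factor (t - 2) / t preserves the invariant,
-- since t (t - 1) · (t - 2) / t = (t - 1) (t - 2).
shrink-step : ∀ t D e e′ K → 1 ≤ t → e * (t ∸ 2) ≤ e′ * t → D * (t * (t ∸ 1)) ≤ e * K →
  D * ((t ∸ 1) * (t ∸ 1 ∸ 1)) ≤ e′ * K
shrink-step t D e e′ K 1≤t drop inv = *-cancelˡ-≤ t {{>-nonZero 1≤t}} (begin
  t * (D * ((t ∸ 1) * (t ∸ 1 ∸ 1)))  ≡⟨ cong (λ s → t * (D * ((t ∸ 1) * s))) (∸-+-assoc t 1 1) ⟩
  t * (D * ((t ∸ 1) * (t ∸ 2)))      ≡⟨ rotate t D (t ∸ 1) (t ∸ 2) ⟩
  (t ∸ 2) * (D * (t * (t ∸ 1)))      ≤⟨ *-monoʳ-≤ (t ∸ 2) inv ⟩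
  (t ∸ 2) * (e * K)                  ≡⟨ *-assoc (t ∸ 2) e K ⟨
  (t ∸ 2) * e * K                    ≤⟨ *-monoˡ-≤ K (subst (_≤ e′ * t) (*-comm e (t ∸ 2)) drop) ⟩
  e′ * t * K                         ≡⟨ rotate′ e′ t K ⟩
  t * (e′ * K)                       ∎)
  where
  open ≤-Reasoning
  rotate : ∀ t D a b → t * (D * (a * b)) ≡ b * (D * (t * a))
  rotate = solve-∀
  rotate′ : ∀ e′ t K → e′ * t * K ≡ t * (e′ * K)
  rotate′ = solve-∀

module _ {n} {A : Fin n → Fin n → Bool} (A-sym : Undirected A) where

  degreeSum-∖⁅⁆ : ∀ R x → degreeSum (A ∖ R) ≤ degreeSum (A ∖ (R ∪⁅ x ⁆)) + 2 * degree (A ∖ R) x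
  degreeSum-∖⁅⁆ R x = ≤-trans (degreeSum-∖ (A ∖ R) (∖-undirected A {R} A-sym) ⁅ x ⁆) (≤-reflexive
    (cong₂ _+_ (sum₂-cong (λ u v → cong 𝟙 (∖-∖ A R ⁅ x ⁆ u v))) (cong (2 *_) (sum-𝟙≟ x (degree (A ∖ R))))))

  degreeSum-∖-pair : ∀ R x y → degreeSum (A ∖ R) ≤
    degreeSum (A ∖ (R ∪⁅ x ⁆ ∪⁅ y ⁆)) + 2 * (degree (A ∖ R) x + degree (A ∖ R) y)
  degreeSum-∖-pair R x y = begin
    degreeSum (A ∖ R)
      ≤⟨ degreeSum-∖⁅⁆ R x ⟩
    degreeSum (A ∖ (R ∪⁅ x ⁆)) + 2 * degree (A ∖ R) x
      ≤⟨ +-monoˡ-≤ (2 * degree (A ∖ R) x) (degreeSum-∖⁅⁆ (R ∪⁅ x ⁆) y) ⟩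
    rest + 2 * degree (A ∖ (R ∪⁅ x ⁆)) y + 2 * degree (A ∖ R) x
      ≤⟨ +-monoˡ-≤ (2 * degree (A ∖ R) x) (+-monoʳ-≤ rest (*-monoʳ-≤ 2 degree-y)) ⟩
    rest + 2 * degree (A ∖ R) y + 2 * degree (A ∖ R) x
      ≡⟨ regroup rest (degree (A ∖ R) y) (degree (A ∖ R) x) ⟩
    rest + 2 * (degree (A ∖ R) x + degree (A ∖ R) y) ∎
    where
    open ≤-Reasoning
    rest = degreeSum (A ∖ (R ∪⁅ x ⁆ ∪⁅ y ⁆))
    regroup : ∀ a b c → a + 2 * b + 2 * c ≡ a + 2 * (c + b)
    regroup = solve-∀
    degree-y : degree (A ∖ (R ∪⁅ x ⁆)) y ≤ degree (A ∖ R) y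
    degree-y = subst (_≤ degree (A ∖ R) y) (sum-cong-≗ (λ v → cong 𝟙 (∖-∖ A R ⁅ x ⁆ y v)))
                     (degree-∖-≤ (A ∖ R) ⁅ x ⁆ y)

module Greedy {n} {A : Fin n → Fin n → Bool} (A-sym : Undirected A) (side : Fin n → Bool) {k}
              (|X| : count side ≡ k) (|Y| : count (not ∘ side) ≡ k) where

  aliveX aliveY : (Fin n → Bool) → Fin n → Bool
  aliveX R = side ∩ (not ∘ R)
  aliveY R = (not ∘ side) ∩ (not ∘ R)

  low-degree-pair : ∀ R {t} → count (aliveX R) ≡ t → count (aliveY R) ≡ t → 0 < t →
    ∃[ x ] ∃[ y ] (side x ≡ true × R x ≡ false) × (side y ≡ false × R y ≡ false) ×
                  t * (degree (A ∖ R) x + degree (A ∖ R) y) ≤ degreeSum (A ∖ R)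
  low-degree-pair R {t} |PX| |PY| 0<t
    with ∃-below-average (aliveX R) (degree (A ∖ R)) (subst (0 <_) (sym |PX|) 0<t)
       | ∃-below-average (aliveY R) (degree (A ∖ R)) (subst (0 <_) (sym |PY|) 0<t)
  ... | x , x∈X∖R , x-low | y , y∈Y∖R , y-low =
    x , y , (proj₁ (∧≡true⁻ x∈X∖R) , not-≡true (proj₂ (∧≡true⁻ x∈X∖R))) ,
            (not-≡true (proj₁ (∧≡true⁻ y∈Y∖R)) , not-≡true (proj₂ (∧≡true⁻ y∈Y∖R))) , (begin
      t * (deg x + deg y)
        ≡⟨ *-distribˡ-+ t (deg x) (deg y) ⟩
      t * deg x + t * deg y
        ≡⟨ cong₂ (λ a b → a * deg x + b * deg y) (sym |PX|) (sym |PY|) ⟩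
      count (aliveX R) * deg x + count (aliveY R) * deg y
        ≤⟨ +-mono-≤ x-low y-low ⟩
      sum (weighted (aliveX R)) + sum (weighted (aliveY R))
        ≡⟨ sum-+ (weighted (aliveX R)) (weighted (aliveY R)) ⟨
      sum (λ u → weighted (aliveX R) u + weighted (aliveY R) u)
        ≤⟨ sum-mono-≤ (λ u → 𝟙-sides (side u) (not (R u)) (deg u)) ⟩
      degreeSum (A ∖ R) ∎)
    where
    open ≤-Reasoning
    deg : Fin n → ℕ
    deg = degree (A ∖ R)
    weighted : (Fin n → Bool) → Fin n → ℕ
    weighted P u = 𝟙 (P u) * deg u
    𝟙-sides : ∀ s b f → 𝟙 (s ∧ b) * f + 𝟙 (not s ∧ b) * f ≤ f
    𝟙-sides true  true  f = ≤-reflexive (trans (+-identityʳ _) (+-identityʳ f))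
    𝟙-sides false true  f = ≤-reflexive (+-identityʳ f)
    𝟙-sides true  false f = z≤n
    𝟙-sides false false f = z≤n

  greedy-step : ∀ R {j} → count (side ∩ R) ≡ j → count ((not ∘ side) ∩ R) ≡ j → j < k →
    ∃[ R′ ] count (side ∩ R′) ≡ suc j × count ((not ∘ side) ∩ R′) ≡ suc j ×
            degreeSum (A ∖ R) * (k ∸ j ∸ 2) ≤ degreeSum (A ∖ R′) * (k ∸ j)
  greedy-step R {j} |R∩X| |R∩Y| j<k
    with low-degree-pair R (count-∩-not side R |X| |R∩X|) (count-∩-not (not ∘ side) R |Y| |R∩Y|)
                           (m<n⇒0<n∸m j<k)
  ... | x , y , (x∈X , x∉R) , (y∉X , y∉R) , low =
    R ∪⁅ x ⁆ ∪⁅ y ⁆ , |R′∩X| , |R′∩Y| ,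
    removal-bound (k ∸ j) (degree (A ∖ R) x + degree (A ∖ R) y) (degreeSum (A ∖ R))
                  (degreeSum (A ∖ (R ∪⁅ x ⁆ ∪⁅ y ⁆))) low (degreeSum-∖-pair A-sym R x y)
    where
    y∉R∪x : (R ∪⁅ x ⁆) y ≡ false
    y∉R∪x = ∪⁅⁆-∉ R y∉R (λ y≡x → contradiction (trans (sym y∉X) (trans (cong side y≡x) x∈X)) λ ())
    |R′∩X| : count (side ∩ (R ∪⁅ x ⁆ ∪⁅ y ⁆)) ≡ suc j
    |R′∩X| = trans (count-∪⁅⁆ side (R ∪⁅ x ⁆) y∉R∪x)
                   (cong₂ _+_ (cong 𝟙 y∉X) (trans (count-∪⁅⁆ side R x∉R)
                                                  (cong₂ _+_ (cong 𝟙 x∈X) |R∩X|)))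
    |R′∩Y| : count ((not ∘ side) ∩ (R ∪⁅ x ⁆ ∪⁅ y ⁆)) ≡ suc j
    |R′∩Y| = trans (count-∪⁅⁆ (not ∘ side) (R ∪⁅ x ⁆) y∉R∪x)
                   (cong₂ _+_ (cong (𝟙 ∘ not) y∉X) (trans (count-∪⁅⁆ (not ∘ side) R x∉R)
                                                          (cong₂ _+_ (cong (𝟙 ∘ not) x∈X) |R∩Y|)))

  greedy-removal : ∀ j → j ≤ k →
    ∃[ R ] count (side ∩ R) ≡ j × count ((not ∘ side) ∩ R) ≡ j ×
           degreeSum A * ((k ∸ j) * (k ∸ j ∸ 1)) ≤ degreeSum (A ∖ R) * (k * (k ∸ 1))
  greedy-removal zero _ = (λ _ → false) , count-∩-∅ side , count-∩-∅ (not ∘ side) , ≤-refl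
    where
    count-∩-∅ : ∀ P → count (P ∩ λ _ → false) ≡ 0
    count-∩-∅ P = trans (sum-cong-≗ (λ i → cong 𝟙 (∧-zeroʳ (P i)))) (sum-zero {n})
  greedy-removal (suc j) j<k =
    let R , |R∩X| , |R∩Y| , bound = greedy-removal j (<⇒≤ j<k)
        R′ , |R′∩X| , |R′∩Y| , drop = greedy-step R |R∩X| |R∩Y| j<k
        shrunk = shrink-step (k ∸ j) (degreeSum A) (degreeSum (A ∖ R)) (degreeSum (A ∖ R′))
                             (k * (k ∸ 1)) (m<n⇒0<n∸m j<k) drop bound
    in R′ , |R′∩X| , |R′∩Y| ,
       subst (λ t → degreeSum A * (t * (t ∸ 1)) ≤ degreeSum (A ∖ R′) * (k * (k ∸ 1)))
             (m∸n∸1≡m∸[1+n] k j) shrunk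

∣∣≡count : ∀ {n} (S : Subset n) → ∣ S ∣ ≡ count (lookup S)
∣∣≡count []          = refl
∣∣≡count (true  ∷ S) = cong suc (∣∣≡count S)
∣∣≡count (false ∷ S) = ∣∣≡count S

∣tabulate∣ : ∀ {n} (P : Fin n → Bool) → ∣ tabulateᵛ P ∣ ≡ count P
∣tabulate∣ P = trans (∣∣≡count (tabulateᵛ P)) (sum-cong-≗ (λ i → cong 𝟙 (lookup∘tabulate P i)))

∈tabulate⁻ : ∀ {n} {P : Fin n → Bool} {i} → i ∈ tabulateᵛ P → P i ≡ true
∈tabulate⁻ {P = P} {i} i∈ = trans (sym (lookup∘tabulate P i)) ([]=⇒lookup i∈)

∼-sym : ∀ {n} (G : Graph n) {u v} → u ∼[ G ] v → v ∼[ G ] u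
∼-sym G {u} {v} u∼v = trans (Graph.sym G v u) u∼v

SidesTriangleFree : ∀ {n} → Graph n → (Fin n → Bool) → Set
SidesTriangleFree G side = ∀ a b c → side a ≡ side b → side a ≡ side c →
  ¬ (a ∼[ G ] b × a ∼[ G ] c × b ∼[ G ] c)

module _ {n} (G : Graph n) (X : Subset n) where

  sidesTriangleFree : TriangleFreeOn G X → TriangleFreeOn G (∁ X) → SidesTriangleFree G (lookup X)
  sidesTriangleFree X-free ∁X-free a b c ab ac with lookup X a in Xa
  ... | true  = X-free a b c (in-X a Xa) (in-X b (sym ab)) (in-X c (sym ac))
    where
    in-X : ∀ u → lookup X u ≡ true → u ∈ X
    in-X u = lookup⇒[]= u X
  ... | false = ∁X-free a b c (in-∁X a Xa) (in-∁X b (sym ab)) (in-∁X c (sym ac))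
    where
    in-∁X : ∀ u → lookup X u ≡ false → u ∈ ∁ X
    in-∁X u Xu = lookup⇒[]= u (∁ X) (trans (lookup-map u not X) (cong not Xu))

  triangleFreeOn-X : SidesTriangleFree G (lookup X) → TriangleFreeOn G X
  triangleFreeOn-X free a b c a∈ b∈ c∈ =
    free a b c (trans (inside a∈) (sym (inside b∈))) (trans (inside a∈) (sym (inside c∈)))
    where
    inside : ∀ {u} → u ∈ X → lookup X u ≡ true
    inside = []=⇒lookup

  triangleFreeOn-∁X : SidesTriangleFree G (lookup X) → TriangleFreeOn G (∁ X)
  triangleFreeOn-∁X free a b c a∈ b∈ c∈ =
    free a b c (trans (outside a∈) (sym (outside b∈))) (trans (outside a∈) (sym (outside c∈)))
    where
    outside : ∀ {u} → u ∈ ∁ X → lookup X u ≡ false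
    outside {u} u∈ = not-≡true (trans (sym (lookup-map u not X)) ([]=⇒lookup u∈))

-- Joining the deleted vertices across the partition

+-≤-one-zero : ∀ {a b d} → a ≤ d → b ≤ d → a ≡ 0 ⊎ b ≡ 0 → a + b ≤ d
+-≤-one-zero a≤d b≤d (inj₁ refl) = b≤d
+-≤-one-zero a≤d b≤d (inj₂ refl) = subst (_≤ _) (sym (+-identityʳ _)) a≤d

module _ {n} (G : Graph n) (side R : Fin n → Bool) where

  crossAdj : Fin n → Fin n → Bool
  crossAdj u v = if R u ∨ R v then side u xor side v else Adj G u v

  crossJoin : Graph n
  crossJoin = record { Adj = crossAdj ; sym = crossAdj-sym ; irrefl = crossAdj-irrefl }
    where
    crossAdj-sym : ∀ u v → crossAdj u v ≡ crossAdj v u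
    crossAdj-sym u v rewrite ∨-comm (R u) (R v) | xor-comm (side u) (side v) | Graph.sym G u v = refl
    crossAdj-irrefl : ∀ u → crossAdj u u ≡ false
    crossAdj-irrefl u with R u
    ... | true  = xor-same (side u)
    ... | false = irrefl G u

  crossAdj-outside : ∀ {u v} → R u ≡ false → R v ≡ false → crossAdj u v ≡ Adj G u v
  crossAdj-outside Ru Rv rewrite Ru | Rv = refl

  crossAdj-inside : ∀ {u v} → R u ≡ true → crossAdj u v ≡ side u xor side v
  crossAdj-inside Ru rewrite Ru = refl

  ∼-same-side : ∀ {u v} → side u ≡ side v → u ∼[ crossJoin ] v → u ∼[ G ] v
  ∼-same-side {u} {v} su≡sv u∼v with R u ∨ R v
  ... | true  = contradiction (trans (sym (xor-same (side u))) (trans (cong (side u xor_) su≡sv) u∼v))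
                              λ ()
  ... | false = u∼v

  ∈R-∼⇒opposite : ∀ {u v} → R u ≡ true → u ∼[ crossJoin ] v → side v ≡ not (side u)
  ∈R-∼⇒opposite {u} {v} Ru u∼v with side u | side v | trans (sym (crossAdj-inside {u} {v} Ru)) u∼v
  ... | true  | false | _ = refl
  ... | false | true  | _ = refl

  ∈R-opposite-∼ : ∀ {u v} → R u ≡ true → side v ≡ not (side u) → u ∼[ crossJoin ] v
  ∈R-opposite-∼ {u} Ru sv≡ =
    trans (crossAdj-inside Ru) (trans (cong (side u xor_) sv≡) (xor-inverseʳ (side u)))

  crossJoin-sidesTriangleFree : SidesTriangleFree G side → SidesTriangleFree crossJoin side
  crossJoin-sidesTriangleFree free a b c ab ac (a∼b , a∼c , b∼c) =
    free a b c ab ac (∼-same-side ab a∼b , ∼-same-side ac a∼c , ∼-same-side (trans (sym ab) ac) b∼c)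

  -- b, c and d are all joined to a, so they lie on the side opposite to a.
  K4-through-R : SidesTriangleFree G side → ∀ {a b c d} → R a ≡ true →
    a ∼[ crossJoin ] b → a ∼[ crossJoin ] c → a ∼[ crossJoin ] d →
    b ∼[ crossJoin ] c → b ∼[ crossJoin ] d → c ∼[ crossJoin ] d → ⊥
  K4-through-R free {b = b} {c} {d} Ra a∼b a∼c a∼d b∼c b∼d c∼d =
    crossJoin-sidesTriangleFree free b c d (trans sb (sym sc)) (trans sb (sym sd)) (b∼c , b∼d , c∼d)
    where
    sb = ∈R-∼⇒opposite Ra a∼b
    sc = ∈R-∼⇒opposite Ra a∼c
    sd = ∈R-∼⇒opposite Ra a∼d

  crossJoin-K4Free : K4Free G → SidesTriangleFree G side → K4Free crossJoin
  crossJoin-K4Free k4 free a b c d (ab , ac , ad , bc , bd , cd)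
    with R a ≟ᵇ true | R b ≟ᵇ true | R c ≟ᵇ true | R d ≟ᵇ true
  ... | yes Ra | _      | _      | _      = K4-through-R free Ra ab ac ad bc bd cd
  ... | no _   | yes Rb | _      | _      = K4-through-R free Rb (∼-sym crossJoin ab) bc bd ac ad cd
  ... | no _   | no _   | yes Rc | _      =
    K4-through-R free Rc (∼-sym crossJoin ac) (∼-sym crossJoin bc) cd ab ad bd
  ... | no _   | no _   | no _   | yes Rd =
    K4-through-R free Rd (∼-sym crossJoin ad) (∼-sym crossJoin bd) (∼-sym crossJoin cd) ab ac bc
  ... | no Ra  | no Rb  | no Rc  | no Rd  =
    k4 a b c d (old Ra Rb ab , old Ra Rc ac , old Ra Rd ad , old Rb Rc bc , old Rb Rd bd , old Rc Rd cd)
    where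
    old : ∀ {u v} → R u ≢ true → R v ≢ true → u ∼[ crossJoin ] v → u ∼[ G ] v
    old Ru Rv = subst (_≡ true) (crossAdj-outside (¬-not Ru) (¬-not Rv))

  independent-∖R : ∀ S → Independent crossJoin S → Independent G (tabulateᵛ (lookup S ∩ (not ∘ R)))
  independent-∖R S S-ind i j i∈ j∈ i∼j =
    S-ind i j (in-S i∈) (in-S j∈) (trans (crossAdj-outside (outside-R i∈) (outside-R j∈)) i∼j)
    where
    in-S : ∀ {u} → u ∈ tabulateᵛ (lookup S ∩ (not ∘ R)) → u ∈ S
    in-S {u} u∈ = lookup⇒[]= u S (proj₁ (∧≡true⁻ (∈tabulate⁻ u∈)))
    outside-R : ∀ {u} → u ∈ tabulateᵛ (lookup S ∩ (not ∘ R)) → R u ≡ false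
    outside-R u∈ = not-≡true (proj₂ (∧≡true⁻ (∈tabulate⁻ u∈)))

  count-∩R∩-≤ : ∀ {d} P Q → count (Q ∩ R) ≡ d → count ((P ∩ R) ∩ Q) ≤ d
  count-∩R∩-≤ P Q |Q∩R| = subst (count ((P ∩ R) ∩ Q) ≤_) |Q∩R| (count-mono-≤ ((P ∩ R) ∩ Q) (Q ∩ R) λ i i∈ →
    let i∈P∩R , i∈Q = ∧≡true⁻ {P i ∧ R i} i∈ in cong₂ _∧_ i∈Q (proj₂ (∧≡true⁻ {P i} i∈P∩R)))

  independent-meets-one-side : ∀ S → Independent crossJoin S →
    count ((lookup S ∩ R) ∩ side) ≡ 0 ⊎ count ((lookup S ∩ R) ∩ (not ∘ side)) ≡ 0
  independent-meets-one-side S S-ind with ∃⊎count≡0 ((lookup S ∩ R) ∩ side)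
  ... | inj₂ none     = inj₁ none
  ... | inj₁ (a , a∈) = inj₂ (count-∄ λ v v∈ →
    let a∈S∩R , a∈X = ∧≡true⁻ {lookup S a ∧ R a} a∈
        v∈S∩R , v∉X = ∧≡true⁻ {lookup S v ∧ R v} v∈
    in S-ind a v (lookup⇒[]= a S (proj₁ (∧≡true⁻ a∈S∩R))) (lookup⇒[]= v S (proj₁ (∧≡true⁻ v∈S∩R)))
                 (∈R-opposite-∼ (proj₂ (∧≡true⁻ a∈S∩R)) (trans (not-≡true v∉X) (sym (cong not a∈X)))))

  independent-∩R-≤ : ∀ {d} → count (side ∩ R) ≡ d → count ((not ∘ side) ∩ R) ≡ d →
    ∀ S → Independent crossJoin S → count (lookup S ∩ R) ≤ d
  independent-∩R-≤ |X∩R| |Y∩R| S S-ind = subst (_≤ _) (sym (count-split (lookup S ∩ R) side))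
    (+-≤-one-zero (count-∩R∩-≤ (lookup S) side |X∩R|) (count-∩R∩-≤ (lookup S) (not ∘ side) |Y∩R|)
                  (independent-meets-one-side S S-ind))

  crossJoin-AlphaLt : ∀ {m d} → AlphaLt G m → count (side ∩ R) ≡ d → count ((not ∘ side) ∩ R) ≡ d →
    AlphaLt crossJoin (m + d)
  crossJoin-AlphaLt {m} {d} α<m |X∩R| |Y∩R| S S-ind = begin-strict
    ∣ S ∣                                                  ≡⟨ ∣∣≡count S ⟩
    count (lookup S)                                       ≡⟨ count-split (lookup S) R ⟩
    count (lookup S ∩ R) + count (lookup S ∩ (not ∘ R))    ≡⟨ +-comm (count (lookup S ∩ R)) _ ⟩
    count (lookup S ∩ (not ∘ R)) + count (lookup S ∩ R)    <⟨ +-mono-<-≤ outside-R inside-R ⟩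
    m + d                                                  ∎
    where
    open ≤-Reasoning
    outside-R : count (lookup S ∩ (not ∘ R)) < m
    outside-R = subst (_< m) (∣tabulate∣ (lookup S ∩ (not ∘ R))) (α<m _ (independent-∖R S S-ind))
    inside-R : count (lookup S ∩ R) ≤ d
    inside-R = independent-∩R-≤ |X∩R| |Y∩R| S S-ind

  crossJoin-degreeSum : ∀ {k d} → count side ≡ k → count (not ∘ side) ≡ k →
    count (side ∩ R) ≡ d → count ((not ∘ side) ∩ R) ≡ d →
    degreeSum crossAdj + d * (d + d) ≡ degreeSum (Adj G ∖ R) + k * (d + d) + k * (d + d)
  crossJoin-degreeSum {k} {d} |X| |Y| |X∩R| |Y∩R| = begin
    degreeSum crossAdj + d * (d + d)                ≡⟨ cong (degreeSum crossAdj +_) both-in-R ⟨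
    sum₂ new + sum₂ RR                              ≡⟨ sum₂-+ new RR ⟨
    sum₂ (λ u v → new u v + RR u v)                 ≡⟨ sum₂-cong split ⟩
    sum₂ (λ u v → kept u v + fromR u v + toR u v)   ≡⟨ sum₂-+ (λ u v → kept u v + fromR u v) toR ⟩
    sum₂ (λ u v → kept u v + fromR u v) + sum₂ toR  ≡⟨ cong (_+ sum₂ toR) (sum₂-+ kept fromR) ⟩
    degreeSum (Adj G ∖ R) + sum₂ fromR + sum₂ toR   ≡⟨ cong₂ (λ x y → _ + x + y) rows columns ⟩
    degreeSum (Adj G ∖ R) + k * (d + d) + k * (d + d) ∎
    where
    open ≡-Reasoning
    opposite : Fin n → Fin n → Bool
    opposite u v = side u xor side v
    new RR kept fromR toR : Fin n → Fin n → ℕ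
    new   u v = 𝟙 (crossAdj u v)
    RR    u v = 𝟙 ((R u ∧ R v) ∧ opposite u v)
    kept  u v = 𝟙 ((Adj G ∖ R) u v)
    fromR u v = 𝟙 (R u ∧ opposite u v)
    toR   u v = 𝟙 (R v ∧ opposite u v)
    -- A pair of vertices of R on opposite sides is counted both in fromR and in toR.
    split : ∀ u v → new u v + RR u v ≡ kept u v + fromR u v + toR u v
    split u v with R u | R v
    ... | true  | true  = refl
    ... | true  | false = refl
    ... | false | true  = +-identityʳ _
    ... | false | false = sym (+-identityʳ _)
    |R| : ∀ c → sum (λ u → 𝟙 (R u) * c) ≡ c * (d + d)
    |R| c = begin
      sum (λ u → 𝟙 (R u) * c)  ≡⟨ sum-cong-≗ (λ u → *-comm (𝟙 (R u)) c) ⟩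
      sum (λ u → c * 𝟙 (R u))  ≡⟨ sum-*ˡ c (𝟙 ∘ R) ⟩
      c * count R              ≡⟨ cong (c *_) (count-split R side) ⟩
      c * (count (R ∩ side) + count (R ∩ (not ∘ side)))
        ≡⟨ cong (c *_) (cong₂ _+_ (trans (count-∩-comm R side) |X∩R|)
                                  (trans (count-∩-comm R (not ∘ side)) |Y∩R|)) ⟩
      c * (d + d)              ∎
    row : ∀ r c → sum (λ v → 𝟙 (r ∧ (c xor side v))) ≡ 𝟙 r * k
    row false _     = sum-zero {n}
    row true  true  = trans |Y| (sym (+-identityʳ k))
    row true  false = trans |X| (sym (+-identityʳ k))
    row-R : ∀ r c → sum (λ v → 𝟙 ((r ∧ R v) ∧ (c xor side v))) ≡ 𝟙 r * d
    row-R false _     = sum-zero {n}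
    row-R true  true  = trans (trans (count-∩-comm R (not ∘ side)) |Y∩R|) (sym (+-identityʳ d))
    row-R true  false = trans (trans (count-∩-comm R side) |X∩R|) (sym (+-identityʳ d))
    rows : sum₂ fromR ≡ k * (d + d)
    rows = trans (sum-cong-≗ (λ u → row (R u) (side u))) (|R| k)
    columns : sum₂ toR ≡ k * (d + d)
    columns = trans (sum-swap toR) (trans (sum-cong-≗ (λ v → trans
      (sum-cong-≗ (λ u → cong (λ b → 𝟙 (R v ∧ b)) (xor-comm (side u) (side v))))
      (row (R v) (side v)))) (|R| k))
    both-in-R : sum₂ RR ≡ d * (d + d)
    both-in-R = trans (sum-cong-≗ (λ u → row-R (R u) (side u))) (|R| d)

  crossJoin-edgeCount : ∀ {k d} → count side ≡ k → count (not ∘ side) ≡ k →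
    count (side ∩ R) ≡ d → count ((not ∘ side) ∩ R) ≡ d →
    edgeCount crossJoin + edgeCount crossJoin + d * (d + d) ≡ degreeSum (Adj G ∖ R) + 2 * (k * (d + d))
  crossJoin-edgeCount {k} {d} |X| |Y| |X∩R| |Y∩R| =
    trans (cong (_+ d * (d + d)) (handshake crossJoin))
          (trans (crossJoin-degreeSum |X| |Y| |X∩R| |Y∩R|) (x+y+y≡x+2y (degreeSum (Adj G ∖ R)) (k * (d + d))))

module _ {n} {G : Graph n} (k4 : K4Free G) (X : Subset n) (halves : ∣ X ∣ + ∣ X ∣ ≡ n)
         (X-free : TriangleFreeOn G X) (∁X-free : TriangleFreeOn G (∁ X)) where

  private
    k = ∣ X ∣
    side = lookup X
    |X| : count side ≡ k
    |X| = sym (∣∣≡count X)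
    |Y| : count (not ∘ side) ≡ k
    |Y| = begin
      count (not ∘ side)   ≡⟨ sum-cong-≗ (λ u → cong 𝟙 (lookup-map u not X)) ⟨
      count (lookup (∁ X)) ≡⟨ ∣∣≡count (∁ X) ⟨
      ∣ ∁ X ∣              ≡⟨ ∣∁p∣≡n∸∣p∣ X ⟩
      n ∸ k                ≡⟨ cong (_∸ k) halves ⟨
      k + k ∸ k            ≡⟨ m+n∸m≡n k k ⟩
      k                    ∎
      where open ≡-Reasoning

  -- e is the degree sum of G with the 2d greedily chosen vertices deleted.
  extension : ∀ {m d} → AlphaLt G m → d ≤ k →
    ∃[ G′ ] ∃[ e ] Nice G′ × AlphaLt G′ (m + d) ×
      (edgeCount G + edgeCount G) * ((k ∸ d) * (k ∸ d ∸ 1)) ≤ e * (k * (k ∸ 1)) ×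
      e + 2 * (k * (d + d)) ≡ edgeCount G′ + edgeCount G′ + d * (d + d)
  extension {m} {d} α<m d≤k with Greedy.greedy-removal (Graph.sym G) side |X| |Y| d d≤k
  ... | R , |X∩R| , |Y∩R| , kept =
    G′ , degreeSum (Adj G ∖ R) , G′-nice , crossJoin-AlphaLt G side R α<m |X∩R| |Y∩R| ,
    subst (λ D → D * ((k ∸ d) * (k ∸ d ∸ 1)) ≤ degreeSum (Adj G ∖ R) * (k * (k ∸ 1)))
          (sym (handshake G)) kept ,
    sym (crossJoin-edgeCount G side R |X| |Y| |X∩R| |Y∩R|)
    where
    G′ = crossJoin G side R
    sides-free : SidesTriangleFree G′ side
    sides-free = crossJoin-sidesTriangleFree G side R (sidesTriangleFree G X X-free ∁X-free)
    G′-nice : Nice G′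
    G′-nice = crossJoin-K4Free G side R k4 (sidesTriangleFree G X X-free ∁X-free) , X , halves ,
              triangleFreeOn-X G′ X sides-free , triangleFreeOn-∁X G′ X sides-free

m+m≤n+n⇒m≤n : ∀ {m n} → m + m ≤ n + n → m ≤ n
m+m≤n+n⇒m≤n {m} {n} = *-cancelˡ-≤ 2 ∘ subst₂ _≤_ (double m) (double n)
  where
  double : ∀ m → m + m ≡ 2 * m
  double = solve-∀

4ad≤[a+d]²-≤ : ∀ {a d} → a ≤ d → 4 * (a * d) ≤ (a + d) * (a + d)
4ad≤[a+d]²-≤ {a} {d} a≤d = subst (λ d → 4 * (a * d) ≤ (a + d) * (a + d)) (m+[n∸m]≡n a≤d)
  (subst (4 * (a * (a + c)) ≤_) (expand a c) (m≤m+n (4 * (a * (a + c))) (c * c)))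
  where
  c = d ∸ a
  expand : ∀ a c → 4 * (a * (a + c)) + c * c ≡ (a + (a + c)) * (a + (a + c))
  expand = solve-∀

4ad≤[a+d]² : ∀ a d → 4 * (a * d) ≤ (a + d) * (a + d)
4ad≤[a+d]² a d with ≤-total a d
... | inj₁ a≤d = 4ad≤[a+d]²-≤ a≤d
... | inj₂ d≤a = subst₂ _≤_ (cong (4 *_) (*-comm d a)) (cong (λ x → x * x) (+-comm d a)) (4ad≤[a+d]²-≤ d≤a)

1+m≤4m : ∀ {m} → 1 ≤ m → suc m ≤ 4 * m
1+m≤4m {m} 1≤m = ≤-trans (+-monoˡ-≤ m 1≤m) (subst (m + m ≤_) (double m) (m≤m+n (m + m) (m + m)))
  where
  double : ∀ m → m + m + (m + m) ≡ 4 * m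
  double = solve-∀

-- With k = a + d: (k - 1) a² D = k · D a (a - 1) + a d D, and a d D ≤ a d (2k)² ≤ k⁴ ≤ 4 (k - 1) k³.
square-bound : ∀ a d e D → 2 ≤ a + d → D ≤ (a + d + (a + d)) * (a + d + (a + d)) →
  D * (a * (a ∸ 1)) ≤ e * ((a + d) * (a + d ∸ 1)) →
  a * a * D ≤ (a + d) * (a + d) * e + 4 * ((a + d) * (a + d) * (a + d))
square-bound zero    d e D _   _  _    = z≤n
square-bound (suc b) d e D 2≤k D≤ kept = *-cancelˡ-≤ (b + d) {{>-nonZero (s≤s⁻¹ 2≤k)}} (begin
  (b + d) * (suc b * suc b * D)
    ≡⟨ expand b d D ⟩
  k * (D * (suc b * b)) + suc b * d * D
    ≤⟨ +-mono-≤ (*-monoʳ-≤ k kept) (*-monoʳ-≤ (suc b * d) D≤) ⟩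
  k * (e * (k * (b + d))) + suc b * d * ((k + k) * (k + k))
    ≡⟨ regroup b d e ⟩
  (b + d) * (k * k * e) + 4 * (suc b * d) * (k * k)
    ≤⟨ +-monoʳ-≤ ((b + d) * (k * k * e)) (*-monoˡ-≤ (k * k) (4ad≤[a+d]² (suc b) d)) ⟩
  (b + d) * (k * k * e) + k * k * (k * k)
    ≤⟨ +-monoʳ-≤ ((b + d) * (k * k * e)) k⁴≤ ⟩
  (b + d) * (k * k * e) + (b + d) * (4 * (k * k * k))
    ≡⟨ *-distribˡ-+ (b + d) (k * k * e) _ ⟨
  (b + d) * (k * k * e + 4 * (k * k * k)) ∎)
  where
  open ≤-Reasoning
  k = suc b + d
  expand : ∀ b d D → (b + d) * (suc b * suc b * D) ≡ (suc b + d) * (D * (suc b * b)) + suc b * d * D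
  expand = solve-∀
  regroup : ∀ b d e → let k = suc b + d in
    k * (e * (k * (b + d))) + suc b * d * ((k + k) * (k + k))
      ≡ (b + d) * (k * k * e) + 4 * (suc b * d) * (k * k)
  regroup = solve-∀
  k⁴≤ : k * k * (k * k) ≤ (b + d) * (4 * (k * k * k))
  k⁴≤ = subst₂ _≤_ (shuffle k) (shuffle′ (b + d) (k * k * k))
               (*-monoˡ-≤ (k * k * k) (1+m≤4m (s≤s⁻¹ 2≤k)))
    where
    shuffle : ∀ k → k * (k * k * k) ≡ k * k * (k * k)
    shuffle = solve-∀
    shuffle′ : ∀ m x → 4 * m * x ≡ m * (4 * x)
    shuffle′ = solve-∀

-- With n = 2k and k = a + d the bound reads 2a² (2s) + 8k³d ≤ 2k² (e + 4kd) + 8k³ ≤ (2k)² (s′ + d² + 2k).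
final-bound′ : ∀ a d s s′ e → let k = a + d in 2 ≤ k → s + s ≤ (k + k) * (k + k) →
  (s + s) * (a * (a ∸ 1)) ≤ e * (k * (k ∸ 1)) → e + 2 * (k * (d + d)) ≤ s′ + s′ + d * (d + d) →
  (k + k ∸ 2 * d) ^ 2 * s + (k + k) ^ 2 * (d * (k + k)) ≤ (k + k) ^ 2 * s′ + (k + k) ^ 2 * (d ^ 2 + (k + k))
final-bound′ a d s s′ e 2≤k 2s≤n² kept edges = begin
  (k + k ∸ 2 * d) ^ 2 * s + (k + k) ^ 2 * (d * (k + k))
    ≡⟨ cong (λ x → x ^ 2 * s + (k + k) ^ 2 * (d * (k + k))) 2k∸2d≡2a ⟩
  (a + a) ^ 2 * s + (k + k) ^ 2 * (d * (k + k))
    ≡⟨ expand a d s ⟩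
  2 * (a * a * (s + s)) + 8 * (k * k * k * d)
    ≤⟨ +-monoˡ-≤ (8 * (k * k * k * d)) (*-monoʳ-≤ 2 (square-bound a d e (s + s) 2≤k 2s≤n² kept)) ⟩
  2 * (k * k * e + 4 * (k * k * k)) + 8 * (k * k * k * d)
    ≡⟨ regroup a d e ⟩
  2 * (k * k) * (e + 2 * (k * (d + d))) + 8 * (k * k * k)
    ≤⟨ +-monoˡ-≤ (8 * (k * k * k)) (*-monoʳ-≤ (2 * (k * k)) edges) ⟩
  2 * (k * k) * (s′ + s′ + d * (d + d)) + 8 * (k * k * k)
    ≡⟨ collect a d s′ ⟩
  (k + k) ^ 2 * s′ + (k + k) ^ 2 * (d ^ 2 + (k + k)) ∎
  where
  open ≤-Reasoning
  k = a + d
  2k∸2d≡2a : k + k ∸ 2 * d ≡ a + a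
  2k∸2d≡2a = trans (cong (_∸ 2 * d) (shuffle a d)) (m+n∸n≡m (a + a) (2 * d))
    where
    shuffle : ∀ a d → a + d + (a + d) ≡ a + a + 2 * d
    shuffle = solve-∀
  -- x ^ 2 unfolds to x * (x * 1), which is how the solver identities below are stated.
  expand : ∀ a d s → let k = a + d in
    (a + a) * ((a + a) * 1) * s + (k + k) * ((k + k) * 1) * (d * (k + k))
      ≡ 2 * (a * a * (s + s)) + 8 * (k * k * k * d)
  expand = solve-∀
  regroup : ∀ a d e → let k = a + d in
    2 * (k * k * e + 4 * (k * k * k)) + 8 * (k * k * k * d)
      ≡ 2 * (k * k) * (e + 2 * (k * (d + d))) + 8 * (k * k * k)
  regroup = solve-∀
  collect : ∀ a d s′ → let k = a + d in
    2 * (k * k) * (s′ + s′ + d * (d + d)) + 8 * (k * k * k)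
      ≡ (k + k) * ((k + k) * 1) * s′ + (k + k) * ((k + k) * 1) * (d * (d * 1) + (k + k))
  collect = solve-∀

final-bound : ∀ k d s s′ e → d ≤ k → 2 ≤ k → s + s ≤ (k + k) * (k + k) →
  (s + s) * ((k ∸ d) * (k ∸ d ∸ 1)) ≤ e * (k * (k ∸ 1)) → e + 2 * (k * (d + d)) ≤ s′ + s′ + d * (d + d) →
  (k + k ∸ 2 * d) ^ 2 * s + (k + k) ^ 2 * (d * (k + k)) ≤ (k + k) ^ 2 * s′ + (k + k) ^ 2 * (d ^ 2 + (k + k))
final-bound k d s s′ e d≤k with k ∸ d | m∸n+n≡m d≤k
... | a | refl = final-bound′ a d s s′ e

lemma9p1 : (d m n : ℕ) → 1 ≤ d → 1 ≤ m → 6 ≤ n → 2 ∣ n → d + d ≤ n →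
    (s s′ : ℕ) → IsS n m s → IsS n (m + d) s′ →
    (n ∸ 2 * d) ^ 2 * s + n ^ 2 * (d * n) ≤ n ^ 2 * s′ + n ^ 2 * (d ^ 2 + n)
lemma9p1 d m n _ _ 6≤n _ 2d≤n s s′ ((G , (k4 , X , halves , X-free , ∁X-free) , α<m , |G|≡s) , _) (_ , maximal) =
  let G′ , e , G′-nice , α′<m+d , kept , edges = extension {G = G} k4 X halves X-free ∁X-free α<m d≤k
      |G′|≤s′ = maximal G′ G′-nice α′<m+d
  in subst (λ n → (n ∸ 2 * d) ^ 2 * s + n ^ 2 * (d * n) ≤ n ^ 2 * s′ + n ^ 2 * (d ^ 2 + n)) halves
       (final-bound k d s s′ e d≤k 2≤k 2s≤n²
          (subst (λ s → (s + s) * ((k ∸ d) * (k ∸ d ∸ 1)) ≤ e * (k * (k ∸ 1))) |G|≡s kept)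
          (≤-trans (≤-reflexive edges) (+-monoˡ-≤ (d * (d + d)) (+-mono-≤ |G′|≤s′ |G′|≤s′))))
  where
  k = ∣ X ∣
  d≤k : d ≤ k
  d≤k = m+m≤n+n⇒m≤n (subst (d + d ≤_) (sym halves) 2d≤n)
  2≤k : 2 ≤ k
  2≤k = m+m≤n+n⇒m≤n (≤-trans (m≤m+n 4 2) (subst (6 ≤_) (sym halves) 6≤n))
  2s≤n² : s + s ≤ (k + k) * (k + k)
  2s≤n² = subst₂ (λ s n → s + s ≤ n * n) |G|≡s (sym halves)
                 (subst (_≤ n * n) (sym (handshake G)) (degreeSum-≤ (Adj G)))
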